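{- In the setting of an instance of SINGLE-VALUED with graph $G=(Q,A,E)$, queries numbered $1,\dots,n$ by arrival, fixed prices $p_l\in[1/e,1]$ with pairwise distinct effective bids $b_l(1-p_l)$, a fixed bidder $j$, and multisets $F_1$ ($k_l$ copies of each $l$ with $b_l(1-p_l)>b_j(1-p_j)$) and $F_2$ ($k_l$ copies of each $l$ with $b_l(1-p_l)<b_j(1-p_j)$): let $S(i)$ (resp. $S_j(i)$) be the multiset obtained by restricting the multiset of available bidders just before query $i$ is processed in run $\mathcal{R}$ (resp. $\mathcal{R}_j$) to the neighbors of $i$ in $G$ (resp. $G_j$), where each bidder $l$ has multiplicity $k_l-d_l$ with $d_l$ the number of queries matched to $l$ so far in that run. Then for each $i$, $1\le i\le n$: (1) $S_j(i)\cap F_1=S(i)\cap F_1$; (2) $S_j(i)\cap F_2\subseteq S(i)\cap F_2$; (3) $S_j(i)\subseteq S(i)$.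
   Context: SINGLE-VALUED: bidders $A$ known in advance, queries $Q$ arrive online; $(i,l)\in E$ iff bidder $l$ is interested in query $i$; bidder $l$ bids the single value $b_l\in\mathbb{Z}_+$ and may be matched to at most $k_l\in\mathbb{Z}_+$ queries. Run $\mathcal{R}$: when query $i$ arrives, each bidder $l$ with $(i,l)\in E$ and $d_l<k_l$ offers effective bid $b_l(1-p_l)$; $i$ is matched to the bidder with the largest effective bid (unmatched if none) and that bidder's $d_l$ increases by 1. $G_j$ is $G$ with bidder $j$ removed and $\mathcal{R}_j$ is the same procedure on $G_j$ with the same prices and arrival order. Multiset conventions: $X\subseteq Y$ means each multiplicity in $X$ is at most that in $Y$; $X\cap Y$ takes minimum multiplicities; $X=Y$ means equal multiplicities. -}

module Defs where

open import Level using (Level)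
open import Data.Nat using (ℕ; zero; suc; _∸_; _<ᵇ_; _⊓_; _≤_)
open import Data.Bool using (Bool; true; false; if_then_else_; _∧_; not)
open import Data.Fin using (Fin; toℕ; _≟_)
open import Data.List using (List; []; _∷_; filter; foldl; take)
open import Data.List.Base using (filterᵇ)
open import Data.Maybe using (Maybe; just; nothing; maybe)
open import Data.Vec.Functional using ()
open import Relation.Nullary.Decidable using (⌊_⌋)
open import Relation.Binary.Bundles using (StrictTotalOrder)
open import Relation.Binary.Definitions using (tri<; tri≈; tri>)
import Data.List as L
open import Data.Fin.Base using () renaming (_↑ˡ_ to _↑ˡ'_)
open import Relation.Binary.PropositionalEquality using (_≡_)
import Data.List.Base as LB

allFinL : (m : ℕ) → List (Fin m)
allFinL m = LB.allFin m

-- A multiset of bidders (Fin m) is its multiplicity function.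
Multiset : ℕ → Set
Multiset m = Fin m → ℕ

_⊆ₘ_ : ∀ {m} → Multiset m → Multiset m → Set
X ⊆ₘ Y = ∀ l → X l ≤ Y l

_∩ₘ_ : ∀ {m} → Multiset m → Multiset m → Multiset m
(X ∩ₘ Y) l = X l ⊓ Y l

_≡ₘ_ : ∀ {m} → Multiset m → Multiset m → Set
X ≡ₘ Y = ∀ l → X l ≡ Y l

module Run {a ℓ₁ ℓ₂ : Level} (O : StrictTotalOrder a ℓ₁ ℓ₂) where
  open StrictTotalOrder O using (compare) renaming (Carrier to V)

  module _ {n m : ℕ}
           (adj : Fin n → Fin m → Bool)   -- (i , l) ∈ E  iff  adj i l ≡ true
           (cap : Fin m → ℕ)
           (eb  : Fin m → V)              -- effective bid b_l (1 - p_l)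
           (present : Fin m → Bool)       -- which bidders are in the graph
           where

    pick : List (Fin m) → Maybe (Fin m)
    pick [] = nothing
    pick (l ∷ ls) with pick ls
    ... | nothing = just l
    ... | just l' with compare (eb l') (eb l)
    ...   | tri< _ _ _ = just l
    ...   | tri≈ _ _ _ = just l'
    ...   | tri> _ _ _ = just l'

    offers : Fin n → (Fin m → ℕ) → Fin m → Bool
    offers i d l = adj i l ∧ present l ∧ (d l <ᵇ cap l)

    incr : (Fin m → ℕ) → Fin m → (Fin m → ℕ)
    incr d l l' = if ⌊ l' ≟ l ⌋ then suc (d l') else d l'

    step : (Fin m → ℕ) → Fin n → (Fin m → ℕ)
    step d i = maybe (incr d) d (pick (filterᵇ (offers i d) (allFinL m)))

    loadsBefore : Fin n → (Fin m → ℕ)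
    loadsBefore i = foldl step (λ _ → 0) (take (toℕ i) (allFinL n))

    S : Fin n → Multiset m
    S i l = if adj i l ∧ present l then cap l ∸ loadsBefore i l else 0

  allPresent : ∀ {m} → Fin m → Bool
  allPresent _ = true

  without : ∀ {m} → Fin m → Fin m → Bool
  without j l = not ⌊ l ≟ j ⌋

  F₁ : ∀ {m} → (Fin m → ℕ) → (Fin m → V) → Fin m → Multiset m
  F₁ cap eb j l with compare (eb j) (eb l)
  ... | tri< _ _ _ = cap l
  ... | tri≈ _ _ _ = 0
  ... | tri> _ _ _ = 0

  F₂ : ∀ {m} → (Fin m → ℕ) → (Fin m → V) → Fin m → Multiset m
  F₂ cap eb j l with compare (eb l) (eb j)
  ... | tri< _ _ _ = cap l
  ... | tri≈ _ _ _ = 0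
  ... | tri> _ _ _ = 0

{-# OPTIONS --safe #-}
-- Run R and Rⱼ side by side, with loads d and dⱼ. By induction over the
-- arrivals, every bidder with a larger effective bid than j has the same load
-- in both runs, and every other bidder except j has at least as large a load
-- in Rⱼ. For the step: Rⱼ's offering bidders are then a subset of R's
-- containing all of R's offering bidders above j. Hence if the two runs choose
-- different bidders, R's choice x does not offer in Rⱼ (it is j or saturated
-- there) and Rⱼ's choice lies below x, so both choices lie below j and the
-- invariant survives. The three claims are read off from the invariant, since
-- S(i) l = k_l − d_l on neighbours of i.
module Submission where

open import Defs
open import Level using (Level)
open import Data.Nat using (ℕ; suc; _∸_; _⊓_; _≤_; _<_; z≤n; s≤s; _<?_)
open import Data.Nat.Properties
  using (<ᵇ⇒<; <⇒<ᵇ; ≮⇒≥; ∸-monoʳ-≤; ⊓-monoˡ-≤; ⊓-zeroʳ; ≤-refl; ≤-trans; ≤-reflexive; <-≤-trans; n≤1+n)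
open import Data.Bool using (Bool; true; false; T)
open import Data.Bool.Properties using (T-∧)
open import Data.Unit using (tt)
open import Data.Fin using (Fin; _≟_; toℕ)
open import Data.Product using (_×_; _,_; proj₁; proj₂)
open import Data.Maybe using (just; nothing)
open import Data.List using (List; []; _∷_; foldl; take)
open import Data.List.Base using (filterᵇ)
open import Data.List.Membership.Propositional using (_∈_; _∉_)
open import Data.List.Membership.Propositional.Properties using (∈-allFin; ∈-filter⁺; ∈-filter⁻)
open import Data.List.Relation.Unary.Any using (here; there)
open import Function using (_∘_)
open import Function.Bundles using (Equivalence)
open import Relation.Nullary using (¬_; yes; no; contradiction)
open import Relation.Nullary.Decidable using (T?)
open import Relation.Binary.PropositionalEquality using (_≡_; _≢_; refl; sym; trans; cong)
open import Relation.Binary.Bundles using (StrictTotalOrder)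
open import Relation.Binary.Definitions using (tri<; tri≈; tri>)

∩ₘ-monoˡ-⊆ : ∀ {m} {X Y : Multiset m} (Z : Multiset m) → X ⊆ₘ Y → (X ∩ₘ Z) ⊆ₘ (Y ∩ₘ Z)
∩ₘ-monoˡ-⊆ Z X⊆Y l = ⊓-monoˡ-≤ (Z l) (X⊆Y l)

module Coupling {a ℓ₁ ℓ₂ : Level} (O : StrictTotalOrder a ℓ₁ ℓ₂) where
  open StrictTotalOrder O
    using (_≈_; compare; irrefl; asym; module Eq) renaming (Carrier to V; _<_ to _≺_; trans to ≺-trans)
  open Run O
  open Equivalence using (to; from)

  T-without⁻ : ∀ {m} {j z : Fin m} → T (without j z) → z ≢ j
  T-without⁻ {j = j} {z} t with z ≟ j
  ... | no z≢j = z≢j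

  T-without⁺ : ∀ {m} {j z : Fin m} → z ≢ j → T (without j z)
  T-without⁺ {j = j} {z} z≢j with z ≟ j
  ... | yes z≡j = z≢j z≡j
  ... | no _ = tt

  module _ {n m : ℕ} (adj : Fin n → Fin m → Bool) (cap : Fin m → ℕ) (eb : Fin m → V) where

    _IsMaxOf_ : Fin m → List (Fin m) → Set ℓ₂
    x IsMaxOf ls = x ∈ ls × (∀ {z} → z ∈ ls → ¬ eb x ≺ eb z)

    module _ (present : Fin m → Bool) where

      pick≡nothing⇒∉ : ∀ ls {z} → pick adj cap eb present ls ≡ nothing → z ∉ ls
      pick≡nothing⇒∉ (l ∷ ls) eq with pick adj cap eb present ls
      pick≡nothing⇒∉ (l ∷ ls) () | nothing
      ... | just l' with compare (eb l') (eb l)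
      pick≡nothing⇒∉ (l ∷ ls) () | just l' | tri< _ _ _
      pick≡nothing⇒∉ (l ∷ ls) () | just l' | tri≈ _ _ _
      pick≡nothing⇒∉ (l ∷ ls) () | just l' | tri> _ _ _

      pick≡just⇒max : ∀ ls {x} → pick adj cap eb present ls ≡ just x → x IsMaxOf ls
      pick≡just⇒max (l ∷ ls) eq with pick adj cap eb present ls in eq'
      pick≡just⇒max (l ∷ ls) refl | nothing =
        here refl , λ { (here refl) → irrefl Eq.refl ; (there z∈) _ → pick≡nothing⇒∉ ls eq' z∈ }
      ... | just l' with compare (eb l') (eb l) | pick≡just⇒max ls eq'
      pick≡just⇒max (l ∷ ls) refl | just l' | tri< l'≺l _ _ | _ , l'-max =
        here refl , λ { (here refl) → irrefl Eq.refl ; (there z∈) l≺z → l'-max z∈ (≺-trans l'≺l l≺z) }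
      pick≡just⇒max (l ∷ ls) refl | just l' | tri≈ l'⊀l _ _ | l'∈ , l'-max =
        there l'∈ , λ { (here refl) → l'⊀l ; (there z∈) → l'-max z∈ }
      pick≡just⇒max (l ∷ ls) refl | just l' | tri> l'⊀l _ _ | l'∈ , l'-max =
        there l'∈ , λ { (here refl) → l'⊀l ; (there z∈) → l'-max z∈ }

      offering : Fin n → (Fin m → ℕ) → List (Fin m)
      offering q d = filterᵇ (offers adj cap eb present q d) (allFinL m)

      ∈-offering⁺ : ∀ {q d z} → T (adj q z) → T (present z) → d z < cap z → z ∈ offering q d
      ∈-offering⁺ {q} {d} {z} adj-qz present-z d<cap =
        ∈-filter⁺ (λ y → T? (offers adj cap eb present q d y)) (∈-allFin z)
          (from T-∧ (adj-qz , from T-∧ (present-z , <⇒<ᵇ d<cap)))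

      ∈-offering⁻ : ∀ {q d z} → z ∈ offering q d → T (adj q z) × T (present z) × d z < cap z
      ∈-offering⁻ {q} {d} {z} z∈
        with to T-∧ (proj₂ (∈-filter⁻ (λ y → T? (offers adj cap eb present q d y)) {xs = allFinL m} z∈))
      ... | adj-qz , rest with to T-∧ rest
      ... | present-z , d<ᵇcap = adj-qz , present-z , <ᵇ⇒< _ _ d<ᵇcap

      -- incr does not inspect present, so these lemmas relate the loads of both runs.
      incr-≢ : ∀ d {x l} → l ≢ x → incr adj cap eb present d x l ≡ d l
      incr-≢ d {x} {l} l≢x with l ≟ x
      ... | yes l≡x = contradiction l≡x l≢x
      ... | no _ = refl

      ≤-incr : ∀ d x l → d l ≤ incr adj cap eb present d x l
      ≤-incr d x l with l ≟ x
      ... | yes _ = n≤1+n _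
      ... | no _ = ≤-refl

      incr-mono-≤ : ∀ d d' x l → d l ≤ d' l → incr adj cap eb present d x l ≤ incr adj cap eb present d' x l
      incr-mono-≤ _ _ x l d≤d' with l ≟ x
      ... | yes _ = s≤s d≤d'
      ... | no _ = d≤d'

      incr-cong : ∀ d d' x l → d l ≡ d' l → incr adj cap eb present d x l ≡ incr adj cap eb present d' x l
      incr-cong _ _ x l d≡d' with l ≟ x
      ... | yes _ = cong suc d≡d'
      ... | no _ = d≡d'

    module _ (distinct : ∀ l l' → l ≢ l' → ¬ eb l ≈ eb l') where

      ≺-max : ∀ {x z ls} → x IsMaxOf ls → z ∈ ls → z ≢ x → eb z ≺ eb x
      ≺-max {x} {z} (_ , x-max) z∈ z≢x with compare (eb z) (eb x)
      ... | tri< z≺x _ _ = z≺x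
      ... | tri≈ _ z≈x _ = contradiction z≈x (distinct z x z≢x)
      ... | tri> _ _ x≺z = contradiction x≺z (x-max z∈)

      module WithoutBidder (j : Fin m) where

        record Coupled (d dⱼ : Fin m → ℕ) : Set ℓ₂ where
          field
            agree-above-j : ∀ l → eb j ≺ eb l → dⱼ l ≡ d l
            ≤-off-j       : ∀ l → l ≢ j → d l ≤ dⱼ l
        open Coupled

        above-j⇒≢j : ∀ {l} → eb j ≺ eb l → l ≢ j
        above-j⇒≢j j≺l refl = irrefl Eq.refl j≺l

        coupled-incr : ∀ {d dⱼ} x → Coupled d dⱼ →
          Coupled (incr adj cap eb allPresent d x) (incr adj cap eb (without j) dⱼ x)
        coupled-incr {d} {dⱼ} x c = record
          { agree-above-j = λ l j≺l → incr-cong allPresent dⱼ d x l (agree-above-j c l j≺l)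
          ; ≤-off-j       = λ l l≢j → incr-mono-≤ allPresent d dⱼ x l (≤-off-j c l l≢j)
          }

        coupled-incrʳ : ∀ {d dⱼ y} → Coupled d dⱼ → ¬ eb j ≺ eb y →
          Coupled d (incr adj cap eb (without j) dⱼ y)
        coupled-incrʳ {dⱼ = dⱼ} {y} c j⊀y = record
          { agree-above-j = λ l j≺l →
              trans (incr-≢ (without j) dⱼ λ { refl → j⊀y j≺l }) (agree-above-j c l j≺l)
          ; ≤-off-j       = λ l l≢j → ≤-trans (≤-off-j c l l≢j) (≤-incr (without j) dⱼ y l)
          }

        coupled-incrˡ : ∀ {d dⱼ x} → Coupled d dⱼ → ¬ eb j ≺ eb x → (x ≢ j → d x < dⱼ x) →
          Coupled (incr adj cap eb allPresent d x) dⱼ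
        coupled-incrˡ {d} {dⱼ} {x} c j⊀x d<dⱼ = record
          { agree-above-j = λ l j≺l →
              trans (agree-above-j c l j≺l) (sym (incr-≢ allPresent d λ { refl → j⊀x j≺l }))
          ; ≤-off-j       = ≤-off-j′
          }
          where
            ≤-off-j′ : ∀ l → l ≢ j → incr adj cap eb allPresent d x l ≤ dⱼ l
            ≤-off-j′ l l≢j with l ≟ x
            ... | yes refl = d<dⱼ l≢j
            ... | no _     = ≤-off-j c l l≢j

        module _ {d dⱼ} (c : Coupled d dⱼ) (q : Fin n) where

          Oᴿ Oᴶ : List (Fin m)
          Oᴿ = offering allPresent q d
          Oᴶ = offering (without j) q dⱼ

          Oᴶ⊆Oᴿ : ∀ {z} → z ∈ Oᴶ → z ∈ Oᴿ
          Oᴶ⊆Oᴿ z∈ with ∈-offering⁻ (without j) z∈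
          ... | adj-qz , z≢j , dⱼ<cap =
            ∈-offering⁺ allPresent adj-qz tt (<-≤-trans (s≤s (≤-off-j c _ (T-without⁻ z≢j))) dⱼ<cap)

          above-j⇒∈Oᴶ : ∀ {z} → z ∈ Oᴿ → eb j ≺ eb z → z ∈ Oᴶ
          above-j⇒∈Oᴶ z∈ j≺z with ∈-offering⁻ allPresent z∈
          ... | adj-qz , _ , d<cap =
            ∈-offering⁺ (without j) adj-qz (T-without⁺ (above-j⇒≢j j≺z))
              (<-≤-trans (s≤s (≤-reflexive (agree-above-j c _ j≺z))) d<cap)

          ∉Oᴶ⇒saturated : ∀ {z} → z ∈ Oᴿ → z ∉ Oᴶ → z ≢ j → d z < dⱼ z
          ∉Oᴶ⇒saturated {z} z∈ z∉ z≢j with ∈-offering⁻ allPresent z∈ | dⱼ z <? cap z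
          ... | adj-qz , _ , _ | yes dⱼ<cap =
            contradiction (∈-offering⁺ (without j) adj-qz (T-without⁺ z≢j) dⱼ<cap) z∉
          ... | _ , _ , d<cap  | no dⱼ≮cap  = <-≤-trans d<cap (≮⇒≥ dⱼ≮cap)

          coupled-skip : ∀ {x} → x ∈ Oᴿ → x ∉ Oᴶ → Coupled (incr adj cap eb allPresent d x) dⱼ
          coupled-skip x∈ x∉ = coupled-incrˡ c (λ j≺x → x∉ (above-j⇒∈Oᴶ x∈ j≺x)) (∉Oᴶ⇒saturated x∈ x∉)

          coupled-step : Coupled (step adj cap eb allPresent d q) (step adj cap eb (without j) dⱼ q)
          coupled-step with pick adj cap eb allPresent Oᴿ in pickᴿ | pick adj cap eb (without j) Oᴶ in pickᴶ
          ... | nothing | nothing = c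
          ... | nothing | just y =
            contradiction (Oᴶ⊆Oᴿ (proj₁ (pick≡just⇒max (without j) Oᴶ pickᴶ)))
                          (pick≡nothing⇒∉ allPresent Oᴿ pickᴿ)
          ... | just x | nothing =
            coupled-skip (proj₁ (pick≡just⇒max allPresent Oᴿ pickᴿ)) (pick≡nothing⇒∉ (without j) Oᴶ pickᴶ)
          ... | just x | just y with x ≟ y
          ...   | yes refl = coupled-incr x c
          ...   | no x≢y = coupled-incrʳ (coupled-skip (proj₁ x-max) x∉Oᴶ) j⊀y
            where
              x-max = pick≡just⇒max allPresent Oᴿ pickᴿ
              y-max = pick≡just⇒max (without j) Oᴶ pickᴶ
              y≺x : eb y ≺ eb x
              y≺x = ≺-max x-max (Oᴶ⊆Oᴿ (proj₁ y-max)) (x≢y ∘ sym)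
              x∉Oᴶ : x ∉ Oᴶ
              x∉Oᴶ x∈ = asym y≺x (≺-max y-max x∈ x≢y)
              j⊀y : ¬ eb j ≺ eb y
              j⊀y j≺y = x∉Oᴶ (above-j⇒∈Oᴶ (proj₁ x-max) (≺-trans j≺y y≺x))

        coupled-foldl : ∀ qs {d dⱼ} → Coupled d dⱼ →
          Coupled (foldl (step adj cap eb allPresent) d qs) (foldl (step adj cap eb (without j)) dⱼ qs)
        coupled-foldl [] c = c
        coupled-foldl (q ∷ qs) c = coupled-foldl qs (coupled-step c q)

        loads-coupled : ∀ i →
          Coupled (loadsBefore adj cap eb allPresent i) (loadsBefore adj cap eb (without j) i)
        loads-coupled i = coupled-foldl (take (toℕ i) (allFinL n))
          record { agree-above-j = λ _ _ → refl ; ≤-off-j = λ _ _ → z≤n }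

        Sⱼ⊆S : ∀ i → S adj cap eb (without j) i ⊆ₘ S adj cap eb allPresent i
        Sⱼ⊆S i l with adj i l | l ≟ j
        ... | false | _      = z≤n
        ... | true  | yes _  = z≤n
        ... | true  | no l≢j = ∸-monoʳ-≤ (cap l) (≤-off-j (loads-coupled i) l l≢j)

        Sⱼ≡S-above-j : ∀ i l → eb j ≺ eb l → S adj cap eb (without j) i l ≡ S adj cap eb allPresent i l
        Sⱼ≡S-above-j i l j≺l with adj i l | l ≟ j
        ... | false | _      = refl
        ... | true  | yes l≡j = contradiction l≡j (above-j⇒≢j j≺l)
        ... | true  | no _   = cong (cap l ∸_) (agree-above-j (loads-coupled i) l j≺l)

        Sⱼ∩F₁≡S∩F₁ : ∀ i →
          (S adj cap eb (without j) i ∩ₘ F₁ cap eb j) ≡ₘ (S adj cap eb allPresent i ∩ₘ F₁ cap eb j)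
        Sⱼ∩F₁≡S∩F₁ i l with compare (eb j) (eb l)
        ... | tri< j≺l _ _ = cong (_⊓ cap l) (Sⱼ≡S-above-j i l j≺l)
        ... | tri≈ _ _ _   = trans (⊓-zeroʳ _) (sym (⊓-zeroʳ _))
        ... | tri> _ _ _   = trans (⊓-zeroʳ _) (sym (⊓-zeroʳ _))

corollary4p4 : {a ℓ₁ ℓ₂ : Level} (O : StrictTotalOrder a ℓ₁ ℓ₂)
    (n m : ℕ) (adj : Fin n → Fin m → Bool) (cap : Fin m → ℕ)
    (eb : Fin m → StrictTotalOrder.Carrier O) →
    (∀ l l' → l ≢ l' → ¬ StrictTotalOrder._≈_ O (eb l) (eb l')) →
    (j : Fin m) (i : Fin n) →
    ((Run.S O adj cap eb (Run.without O j) i ∩ₘ Run.F₁ O cap eb j)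
        ≡ₘ (Run.S O adj cap eb (Run.allPresent O) i ∩ₘ Run.F₁ O cap eb j))
    × ((Run.S O adj cap eb (Run.without O j) i ∩ₘ Run.F₂ O cap eb j)
        ⊆ₘ (Run.S O adj cap eb (Run.allPresent O) i ∩ₘ Run.F₂ O cap eb j))
    × (Run.S O adj cap eb (Run.without O j) i ⊆ₘ Run.S O adj cap eb (Run.allPresent O) i)
corollary4p4 O n m adj cap eb distinct j i =
  Sⱼ∩F₁≡S∩F₁ i , ∩ₘ-monoˡ-⊆ (Run.F₂ O cap eb j) (Sⱼ⊆S i) , Sⱼ⊆S i
  where open Coupling O
        open WithoutBidder adj cap eb distinct j
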